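{- Let $(u_n)_{n \geq 1}$ be a sequence of positive integers with $u_n \to +\infty$ as $n \to +\infty$, and let $k$ be a positive integer. Then $$\sum_{n=1}^{+\infty} (-1)^{u_n - n} \frac{F_{u_{n+2k} - u_n}}{F_{u_n} F_{u_{n+2k}}} = \sum_{n=1}^{k} (-1)^{u_{2n-1}+1} \frac{F_{u_{2n} - u_{2n-1}}}{F_{u_{2n}} F_{u_{2n-1}}}.$$ In particular, if $u_n \equiv n \pmod 2$ for every positive integer $n$, then $$\sum_{n=1}^{+\infty} \frac{F_{u_{n+2k} - u_n}}{F_{u_n} F_{u_{n+2k}}} = \sum_{n=1}^{k} \frac{F_{u_{2n} - u_{2n-1}}}{F_{u_{2n}} F_{u_{2n-1}}}.$$
   Context: $(F_n)_{n \in \mathbb{Z}}$ is the Fibonacci sequence: $F_0 = 0$, $F_1 = 1$, $F_{n+2} = F_{n+1} + F_n$ for all $n \in \mathbb{Z}$ (so that $F_{ -n} = (-1)^{n+1} F_n$). -}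

module Defs where

open import Data.Nat as ℕ using (ℕ; zero; suc)
open import Data.Integer as ℤ using (ℤ; +_; -[1+_])
open import Data.Rational as ℚ using (ℚ; 0ℚ; _/_)
open import Data.Product using (∃)

fibℕ : ℕ → ℕ
fibℕ zero = 0
fibℕ (suc zero) = 1
fibℕ (suc (suc n)) = fibℕ (suc n) ℕ.+ fibℕ n

negOnePowℕ : ℕ → ℤ
negOnePowℕ zero = ℤ.+ 1
negOnePowℕ (suc n) = ℤ.- negOnePowℕ n

-- (-1)^z for z : ℤ (depends only on the parity of z)
negOnePow : ℤ → ℤ
negOnePow z = negOnePowℕ ℤ.∣ z ∣

-- Fibonacci numbers on ℤ: F_n for n ≥ 0, and F_{-m} = (-1)^{m+1} F_m
fib : ℤ → ℤ
fib (+ n) = + fibℕ n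
fib -[1+ n ] = negOnePowℕ n ℤ.* (+ fibℕ (suc n))

-- a / b as a rational number, for integers a, b (with the junk value 0 when b = 0)
frac : ℤ → ℤ → ℚ
frac a (+ zero) = 0ℚ
frac a (+ suc n) = a / suc n
frac a -[1+ n ] = (ℤ.- a) / suc n

sum1 : (ℕ → ℚ) → ℕ → ℚ
sum1 f zero = 0ℚ
sum1 f (suc M) = sum1 f M ℚ.+ f (suc M)

TendsToInfinity : (ℕ → ℕ) → Set
TendsToInfinity u = ∀ (B : ℕ) → ∃ λ N → ∀ n → N ℕ.≤ n → B ℕ.≤ u n

SeriesConvergesTo : (ℕ → ℚ) → ℚ → Set
SeriesConvergesTo f L =
  ∀ (ε : ℚ) → 0ℚ ℚ.< ε → ∃ λ N → ∀ M → N ℕ.≤ M → ℚ.∣ sum1 f M ℚ.- L ∣ ℚ.< ε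

-- Write G m = F (m+1) / F m. D'Ocagne's identity F b F (a+1) − F (b+1) F a = (−1)^a F (b−a), valid for all
-- integers b, gives (−1)^a F (b−a) / (F a F b) = G a − G b. So with h n = (−1)^n G (u n), the n-th term of the
-- series is h n − h (n+2k), and the right-hand side is h 1 + ⋯ + h (2k). The M-th partial sum telescopes to
-- (h 1 + ⋯ + h (2k)) − (h (M+1) + ⋯ + h (M+2k)), and this tail, grouped into k consecutive pairs
-- h n + h (n+1) = ±(G (u n) − G (u (n+1))), is at most k / min F (u n), which tends to 0 since u n → ∞.
-- Under the parity hypothesis every sign (−1)^(u n − n) and (−1)^(u (2n−1) + 1) is 1.

module Submission where

open import Defs
open import Data.Nat using (ℕ; _≤_; _+_; _*_; _∸_; _%_)
open import Data.Integer using (ℤ; +_; _-_)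
open import Data.Product using (_×_)
open import Relation.Binary.PropositionalEquality using (_≡_)

open import Data.Nat as ℕ using (zero; suc; z≤n; s≤s)
import Data.Nat.Properties as ℕP
open import Data.Nat.DivMod using ([m+n]%n≡m%n)
open import Data.Integer as ℤ using (-[1+_])
import Data.Integer.Properties as ℤP
open import Data.Sum using (inj₁; inj₂)
open import Relation.Binary.PropositionalEquality using (refl; sym; trans; cong; cong₂; subst; subst₂; module ≡-Reasoning)
open import Data.Product using (∃; _,_)
import Data.Integer.Solver as ℤSolver
open import Data.Rational as ℚ using (ℚ; 0ℚ; 1ℚ; mkℚ)
import Data.Rational.Properties as ℚP
open import Data.Rational.Literals using (fromℤ)
open import Data.Rational.Unnormalised as ℚᵘ using (mkℚᵘ; *≡*; *≤*; *<*)
import Data.Rational.Unnormalised.Properties as ℚᵘP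
import Data.Rational.Solver as ℚSolver

negOnePowℕ-+ : ∀ m n → negOnePowℕ (m + n) ≡ negOnePowℕ m ℤ.* negOnePowℕ n
negOnePowℕ-+ zero    n = sym (ℤP.*-identityˡ (negOnePowℕ n))
negOnePowℕ-+ (suc m) n = trans (cong ℤ.-_ (negOnePowℕ-+ m n)) (ℤP.neg-distribˡ-* (negOnePowℕ m) (negOnePowℕ n))

negOnePowℕ-square : ∀ n → negOnePowℕ n ℤ.* negOnePowℕ n ≡ + 1
negOnePowℕ-square zero    = refl
negOnePowℕ-square (suc n) =
  trans (solve 1 (λ x → (:- x) :* (:- x) := x :* x) refl (negOnePowℕ n)) (negOnePowℕ-square n)
  where open ℤSolver.+-*-Solver

negOnePowℕ-even : ∀ n → negOnePowℕ (2 * n) ≡ + 1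
negOnePowℕ-even n = trans (negOnePowℕ-+ n (n + 0))
  (trans (cong (λ m → negOnePowℕ n ℤ.* negOnePowℕ m) (ℕP.+-identityʳ n)) (negOnePowℕ-square n))

1≤2*[1+j]∸1 : ∀ j → 1 ≤ 2 * suc j ∸ 1
1≤2*[1+j]∸1 j = subst (λ m → 1 ≤ m ∸ 1) (sym (ℕP.*-suc 2 j)) (s≤s z≤n)

negOnePowℕ-odd : ∀ j → negOnePowℕ (2 * suc j ∸ 1) ≡ ℤ.- + 1
negOnePowℕ-odd j = trans (cong (λ m → negOnePowℕ (m ∸ 1)) (ℕP.*-suc 2 j)) (cong ℤ.-_ (negOnePowℕ-even j))

negOnePowℕ-%2 : ∀ n → negOnePowℕ n ≡ negOnePowℕ (n % 2)
negOnePowℕ-%2 zero          = refl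
negOnePowℕ-%2 (suc zero)    = refl
negOnePowℕ-%2 (suc (suc n)) = trans (ℤP.neg-involutive (negOnePowℕ n))
  (trans (negOnePowℕ-%2 n) (cong negOnePowℕ (sym (trans (cong (_% 2) (ℕP.+-comm 2 n)) ([m+n]%n≡m%n n 2)))))

negOnePowℕ-cong-%2 : ∀ m n → m % 2 ≡ n % 2 → negOnePowℕ m ≡ negOnePowℕ n
negOnePowℕ-cong-%2 m n eq = trans (negOnePowℕ-%2 m) (trans (cong negOnePowℕ eq) (sym (negOnePowℕ-%2 n)))

∣negOnePowℕ∣≡1 : ∀ n → ℤ.∣ negOnePowℕ n ∣ ≡ 1
∣negOnePowℕ∣≡1 zero    = refl
∣negOnePowℕ∣≡1 (suc n) = trans (ℤP.∣-i∣≡∣i∣ (negOnePowℕ n)) (∣negOnePowℕ∣≡1 n)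

negOnePow-+1 : ∀ z → negOnePow (z ℤ.+ + 1) ≡ ℤ.- negOnePow z
negOnePow-+1 (+ n)        = cong negOnePowℕ (ℕP.+-comm n 1)
negOnePow-+1 -[1+ zero ]  = refl
negOnePow-+1 -[1+ suc n ] = sym (ℤP.neg-involutive (negOnePowℕ (suc n)))

negOnePow-sub : ∀ m n → negOnePow (+ m - + n) ≡ negOnePowℕ m ℤ.* negOnePowℕ n
negOnePow-sub zero    n = trans (cong negOnePow (ℤP.+-identityˡ (ℤ.- + n)))
  (trans (cong negOnePowℕ (ℤP.∣-i∣≡∣i∣ (+ n))) (sym (ℤP.*-identityˡ (negOnePowℕ n))))
negOnePow-sub (suc m) n = begin
  negOnePow (+ suc m - + n)           ≡⟨ cong negOnePow (ℤP.+-assoc (+ 1) (+ m) (ℤ.- + n)) ⟩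
  negOnePow (+ 1 ℤ.+ (+ m - + n))     ≡⟨ cong negOnePow (ℤP.+-comm (+ 1) (+ m - + n)) ⟩
  negOnePow ((+ m - + n) ℤ.+ + 1)     ≡⟨ negOnePow-+1 (+ m - + n) ⟩
  ℤ.- negOnePow (+ m - + n)           ≡⟨ cong ℤ.-_ (negOnePow-sub m n) ⟩
  ℤ.- (negOnePowℕ m ℤ.* negOnePowℕ n) ≡⟨ ℤP.neg-distribˡ-* (negOnePowℕ m) (negOnePowℕ n) ⟩
  negOnePowℕ (suc m) ℤ.* negOnePowℕ n ∎
  where open ≡-Reasoning

negOnePow-sub≡1 : ∀ m n → m % 2 ≡ n % 2 → negOnePow (+ m - + n) ≡ + 1
negOnePow-sub≡1 m n m≡n = trans (negOnePow-sub m n)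
  (trans (cong (ℤ._* negOnePowℕ n) (negOnePowℕ-cong-%2 m n m≡n)) (negOnePowℕ-square n))

negOnePow-+1≡1 : ∀ m j → m % 2 ≡ (2 * suc j ∸ 1) % 2 → negOnePow (+ m ℤ.+ + 1) ≡ + 1
negOnePow-+1≡1 m j m≡odd = trans (negOnePowℕ-+ m 1)
  (cong (ℤ._* ℤ.- + 1) (trans (negOnePowℕ-cong-%2 m (2 * suc j ∸ 1) m≡odd) (negOnePowℕ-odd j)))

fib-+2 : ∀ z → fib (z ℤ.+ + 2) ≡ fib (z ℤ.+ + 1) ℤ.+ fib z
fib-+2 (+ n) rewrite ℕP.+-comm n 2 | ℕP.+-comm n 1 = refl
fib-+2 -[1+ zero ]        = refl
fib-+2 -[1+ suc zero ]    = refl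
fib-+2 -[1+ suc (suc n) ] =
  solve 3 (λ s a b → s :* a := (:- s) :* b :+ (:- (:- s)) :* (b :+ a)) refl
    (negOnePowℕ n) (+ fibℕ (suc n)) (+ fibℕ (suc (suc n)))
  where open ℤSolver.+-*-Solver

fib-+1 : ∀ z → fib (z ℤ.+ + 1) ≡ fib z ℤ.+ fib (z - + 1)
fib-+1 z = begin
  fib (z ℤ.+ + 1)
    ≡⟨ cong fib (solve 1 (λ z → z :+ con (+ 1) := (z :- con (+ 1)) :+ con (+ 2)) refl z) ⟩
  fib ((z - + 1) ℤ.+ + 2)
    ≡⟨ fib-+2 (z - + 1) ⟩
  fib ((z - + 1) ℤ.+ + 1) ℤ.+ fib (z - + 1)
    ≡⟨ cong (λ x → fib x ℤ.+ fib (z - + 1)) (solve 1 (λ z → (z :- con (+ 1)) :+ con (+ 1) := z) refl z) ⟩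
  fib z ℤ.+ fib (z - + 1) ∎
  where
  open ≡-Reasoning
  open ℤSolver.+-*-Solver

fib-dOcagne : ∀ a b →
  fib b ℤ.* fib (+ suc a) - fib (b ℤ.+ + 1) ℤ.* fib (+ a) ≡ negOnePowℕ a ℤ.* fib (b - + a)
fib-dOcagne zero b =
  trans (solve 2 (λ x y → x :* con (+ 1) :- y :* con (+ 0) := con (+ 1) :* x) refl (fib b) (fib (b ℤ.+ + 1)))
        (cong (λ x → + 1 ℤ.* fib x) (sym (ℤP.+-identityʳ b)))
  where open ℤSolver.+-*-Solver
fib-dOcagne (suc a) b = begin
  fib b ℤ.* (A ℤ.+ C) - fib (b ℤ.+ + 1) ℤ.* A
    ≡⟨ cong (λ x → fib b ℤ.* (A ℤ.+ C) - x ℤ.* A) (fib-+1 b) ⟩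
  fib b ℤ.* (A ℤ.+ C) - (fib b ℤ.+ fib b′) ℤ.* A
    ≡⟨ solve 4 (λ x y A C → x :* (A :+ C) :- (x :+ y) :* A := :- (y :* A :- x :* C)) refl (fib b) (fib b′) A C ⟩
  ℤ.- (fib b′ ℤ.* A - fib b ℤ.* C)
    ≡⟨ cong (λ x → ℤ.- (fib b′ ℤ.* A - fib x ℤ.* C)) (solve 1 (λ b → b := (b :- con (+ 1)) :+ con (+ 1)) refl b) ⟩
  ℤ.- (fib b′ ℤ.* A - fib (b′ ℤ.+ + 1) ℤ.* C)
    ≡⟨ cong ℤ.-_ (fib-dOcagne a b′) ⟩
  ℤ.- (negOnePowℕ a ℤ.* fib (b′ - + a))
    ≡⟨ ℤP.neg-distribˡ-* (negOnePowℕ a) (fib (b′ - + a)) ⟩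
  negOnePowℕ (suc a) ℤ.* fib (b′ - + a)
    ≡⟨ cong (λ x → negOnePowℕ (suc a) ℤ.* fib x) (solve 2 (λ b a → (b :- con (+ 1)) :- a := b :- (con (+ 1) :+ a)) refl b (+ a)) ⟩
  negOnePowℕ (suc a) ℤ.* fib (b - + suc a) ∎
  where
  open ≡-Reasoning
  open ℤSolver.+-*-Solver
  A C b′ : ℤ
  A = fib (+ suc a)
  C = fib (+ a)
  b′ = b - + 1

∣fib∣≡fibℕ∣∣ : ∀ z → ℤ.∣ fib z ∣ ≡ fibℕ ℤ.∣ z ∣
∣fib∣≡fibℕ∣∣ (+ n)    = refl
∣fib∣≡fibℕ∣∣ -[1+ n ] = trans (ℤP.abs-* (negOnePowℕ n) (+ fibℕ (suc n)))
  (trans (cong (ℕ._* fibℕ (suc n)) (∣negOnePowℕ∣≡1 n)) (ℕP.*-identityˡ (fibℕ (suc n))))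

fibℕ≤fibℕ[1+n] : ∀ n → fibℕ n ≤ fibℕ (suc n)
fibℕ≤fibℕ[1+n] zero    = z≤n
fibℕ≤fibℕ[1+n] (suc n) = ℕP.m≤m+n (fibℕ (suc n)) (fibℕ n)

fibℕ-mono-≤ : ∀ {m n} → m ≤ n → fibℕ m ≤ fibℕ n
fibℕ-mono-≤ m≤n = mono (ℕP.≤⇒≤′ m≤n)
  where
  mono : ∀ {m n} → m ℕ.≤′ n → fibℕ m ≤ fibℕ n
  mono ℕ.≤′-refl          = ℕP.≤-refl
  mono (ℕ.≤′-step {n} p) = ℕP.≤-trans (mono p) (fibℕ≤fibℕ[1+n] n)

n≤fibℕ[1+n] : ∀ n → n ≤ fibℕ (suc n)
n≤fibℕ[1+n] zero                = z≤n
n≤fibℕ[1+n] (suc zero)          = s≤s z≤n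
n≤fibℕ[1+n] (suc (suc zero))    = s≤s (s≤s z≤n)
n≤fibℕ[1+n] (suc (suc (suc n))) =
  ℕP.≤-trans (s≤s (s≤s (ℕP.m≤n+m (suc n) n))) (ℕP.+-mono-≤ (n≤fibℕ[1+n] (suc (suc n))) (n≤fibℕ[1+n] (suc n)))

fibℕ∘-tendsToInfinity : ∀ {u} → TendsToInfinity u → TendsToInfinity (λ n → fibℕ (u n))
fibℕ∘-tendsToInfinity u→∞ B with u→∞ (suc B)
... | N , B<u = N , λ n N≤n → B≤fibℕ (B<u n N≤n)
  where
  B≤fibℕ : ∀ {m} → suc B ≤ m → B ≤ fibℕ m
  B≤fibℕ {suc m} (s≤s B≤m) = ℕP.≤-trans B≤m (n≤fibℕ[1+n] m)

fibℕ-nonZero : ∀ {n} → 1 ≤ n → ℕ.NonZero (fibℕ n)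
fibℕ-nonZero 1≤n = ℕ.>-nonZero (fibℕ-mono-≤ 1≤n)

∣+m-+n∣≤m⊔n : ∀ m n → ℤ.∣ + m - + n ∣ ≤ m ℕ.⊔ n
∣+m-+n∣≤m⊔n m n = subst (λ z → ℤ.∣ z ∣ ≤ m ℕ.⊔ n) (sym (ℤP.m-n≡m⊖n m n)) (ℤP.∣m⊝n∣≤m⊔n m n)

fibℕ∣b-a∣*c≤fibℕa*fibℕb : ∀ a b {c} → c ≤ fibℕ a → c ≤ fibℕ b →
  fibℕ ℤ.∣ + b - + a ∣ ℕ.* c ≤ fibℕ a ℕ.* fibℕ b
fibℕ∣b-a∣*c≤fibℕa*fibℕb a b {c} c≤Fa c≤Fb with ℕP.≤-total a b
... | inj₁ a≤b = begin
  fibℕ ℤ.∣ + b - + a ∣ ℕ.* c ≤⟨ ℕP.*-mono-≤ (fibℕ-mono-≤ ∣b-a∣≤b) c≤Fa ⟩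
  fibℕ b ℕ.* fibℕ a          ≡⟨ ℕP.*-comm (fibℕ b) (fibℕ a) ⟩
  fibℕ a ℕ.* fibℕ b          ∎
  where
  open ℕP.≤-Reasoning
  ∣b-a∣≤b : ℤ.∣ + b - + a ∣ ≤ b
  ∣b-a∣≤b = ℕP.≤-trans (∣+m-+n∣≤m⊔n b a) (ℕP.≤-reflexive (ℕP.m≥n⇒m⊔n≡m a≤b))
... | inj₂ b≤a = ℕP.*-mono-≤ (fibℕ-mono-≤ ∣b-a∣≤a) c≤Fb
  where
  ∣b-a∣≤a : ℤ.∣ + b - + a ∣ ≤ a
  ∣b-a∣≤a = ℕP.≤-trans (∣+m-+n∣≤m⊔n b a) (ℕP.≤-reflexive (ℕP.m≤n⇒m⊔n≡n b≤a))

fromℤ-+ : ∀ a b → fromℤ (a ℤ.+ b) ≡ fromℤ a ℚ.+ fromℤ b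
fromℤ-+ a b = ℚP.toℚᵘ-injective (ℚᵘP.≃-sym (ℚᵘP.≃-trans (ℚP.toℚᵘ-homo-+ (fromℤ a) (fromℤ b))
  (*≡* (solve 2 (λ a b → (a :* con (+ 1) :+ b :* con (+ 1)) :* con (+ 1) := (a :+ b) :* con (+ 1)) refl a b))))
  where open ℤSolver.+-*-Solver

fromℤ-* : ∀ a b → fromℤ (a ℤ.* b) ≡ fromℤ a ℚ.* fromℤ b
fromℤ-* a b = ℚP.toℚᵘ-injective (ℚᵘP.≃-sym (ℚP.toℚᵘ-homo-* (fromℤ a) (fromℤ b)))

fromℤ-neg : ∀ a → fromℤ (ℤ.- a) ≡ ℚ.- fromℤ a
fromℤ-neg (+ zero)  = refl
fromℤ-neg (+ suc n) = refl
fromℤ-neg -[1+ n ]  = refl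

fromℤ-- : ∀ a b → fromℤ (a - b) ≡ fromℤ a ℚ.- fromℤ b
fromℤ-- a b = trans (fromℤ-+ a (ℤ.- b)) (cong (fromℤ a ℚ.+_) (fromℤ-neg b))

∣fromℤ-negOnePowℕ*q∣≡∣q∣ : ∀ n q → ℚ.∣ fromℤ (negOnePowℕ n) ℚ.* q ∣ ≡ ℚ.∣ q ∣
∣fromℤ-negOnePowℕ*q∣≡∣q∣ zero    q = cong ℚ.∣_∣ (ℚP.*-identityˡ q)
∣fromℤ-negOnePowℕ*q∣≡∣q∣ (suc n) q = begin
  ℚ.∣ fromℤ (ℤ.- negOnePowℕ n) ℚ.* q ∣   ≡⟨ cong (λ x → ℚ.∣ x ℚ.* q ∣) (fromℤ-neg (negOnePowℕ n)) ⟩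
  ℚ.∣ ℚ.- fromℤ (negOnePowℕ n) ℚ.* q ∣   ≡⟨ cong ℚ.∣_∣ (ℚP.neg-distribˡ-* (fromℤ (negOnePowℕ n)) q) ⟨
  ℚ.∣ ℚ.- (fromℤ (negOnePowℕ n) ℚ.* q) ∣ ≡⟨ ℚP.∣-p∣≡∣p∣ (fromℤ (negOnePowℕ n) ℚ.* q) ⟩
  ℚ.∣ fromℤ (negOnePowℕ n) ℚ.* q ∣       ≡⟨ ∣fromℤ-negOnePowℕ*q∣≡∣q∣ n q ⟩
  ℚ.∣ q ∣                               ∎
  where open ≡-Reasoning

*-cancelʳ-≡ : ∀ p q r .{{_ : ℚ.NonZero r}} → p ℚ.* r ≡ q ℚ.* r → p ≡ q
*-cancelʳ-≡ p q r pr≡qr = trans (sym (*r*1/r p)) (trans (cong (ℚ._* ℚ.1/ r) pr≡qr) (*r*1/r q))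
  where
  *r*1/r : ∀ x → x ℚ.* r ℚ.* ℚ.1/ r ≡ x
  *r*1/r x = trans (ℚP.*-assoc x r (ℚ.1/ r)) (trans (cong (x ℚ.*_) (ℚP.*-inverseʳ r)) (ℚP.*-identityʳ x))

frac-*-den : ∀ x d .{{_ : ℤ.NonZero d}} → frac x d ℚ.* fromℤ d ≡ fromℤ x
frac-*-den x (+ suc n) = ℚP.toℚᵘ-injective (ℚᵘP.≃-trans (ℚP.toℚᵘ-homo-* (frac x (+ suc n)) (fromℤ (+ suc n)))
  (ℚᵘP.≃-trans (ℚᵘP.*-congʳ (ℚP.toℚᵘ-fromℚᵘ (mkℚᵘ x n)))
    (*≡* (trans (ℤP.*-identityʳ _) (cong (λ m → x ℤ.* + m) (sym (ℕP.*-identityʳ (suc n))))))))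
frac-*-den x -[1+ n ] = begin
  frac (ℤ.- x) (+ suc n) ℚ.* ℚ.- fromℤ (+ suc n)   ≡⟨ ℚP.neg-distribʳ-* (frac (ℤ.- x) (+ suc n)) (fromℤ (+ suc n)) ⟨
  ℚ.- (frac (ℤ.- x) (+ suc n) ℚ.* fromℤ (+ suc n)) ≡⟨ cong ℚ.-_ (frac-*-den (ℤ.- x) (+ suc n)) ⟩
  ℚ.- fromℤ (ℤ.- x)                                 ≡⟨ sym (fromℤ-neg (ℤ.- x)) ⟩
  fromℤ (ℤ.- ℤ.- x)                                 ≡⟨ cong fromℤ (ℤP.neg-involutive x) ⟩
  fromℤ x                                           ∎
  where open ≡-Reasoning

frac-unique : ∀ q x d .{{_ : ℤ.NonZero d}} → q ℚ.* fromℤ d ≡ fromℤ x → q ≡ frac x d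
frac-unique q x d qd≡x = *-cancelʳ-≡ q (frac x d) (fromℤ d) (trans qd≡x (sym (frac-*-den x d)))

frac-*ˡ : ∀ c x d .{{_ : ℤ.NonZero d}} → frac (c ℤ.* x) d ≡ fromℤ c ℚ.* frac x d
frac-*ˡ c x d = sym (frac-unique _ (c ℤ.* x) d (begin
  fromℤ c ℚ.* frac x d ℚ.* fromℤ d   ≡⟨ ℚP.*-assoc (fromℤ c) (frac x d) (fromℤ d) ⟩
  fromℤ c ℚ.* (frac x d ℚ.* fromℤ d) ≡⟨ cong (fromℤ c ℚ.*_) (frac-*-den x d) ⟩
  fromℤ c ℚ.* fromℤ x                ≡⟨ sym (fromℤ-* c x) ⟩
  fromℤ (c ℤ.* x)                    ∎))
  where open ≡-Reasoning

frac-*ˡ-+1 : ∀ {c} x d → c ≡ + 1 → frac (c ℤ.* x) d ≡ frac x d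
frac-*ˡ-+1 x d refl = cong (λ y → frac y d) (ℤP.*-identityˡ x)

∣frac∣≤1/ : ∀ x n m .{{_ : ℕ.NonZero n}} .{{_ : ℕ.NonZero m}} →
  ℤ.∣ x ∣ ℕ.* m ≤ n → ℚ.∣ frac x (+ n) ∣ ℚ.≤ + 1 ℚ./ m
∣frac∣≤1/ x (suc n) (suc m) ∣x∣*m≤n = ℚP.toℚᵘ-cancel-≤
  (ℚᵘP.≤-respˡ-≃ ∣x∣/n≃ (ℚᵘP.≤-respʳ-≃ (ℚᵘP.≃-sym (ℚP.toℚᵘ-fromℚᵘ (mkℚᵘ (+ 1) m))) (*≤* cross)))
  where
  ∣x∣/n≃ : mkℚᵘ (+ ℤ.∣ x ∣) n ℚᵘ.≃ ℚ.toℚᵘ ℚ.∣ frac x (+ suc n) ∣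
  ∣x∣/n≃ = ℚᵘP.≃-sym (ℚᵘP.≃-trans (ℚP.toℚᵘ-homo-∣-∣ (frac x (+ suc n)))
    (ℚᵘP.∣-∣-cong (ℚP.toℚᵘ-fromℚᵘ (mkℚᵘ x n))))
  cross : + ℤ.∣ x ∣ ℤ.* + suc m ℤ.≤ + 1 ℤ.* + suc n
  cross = subst₂ ℤ._≤_ (ℤP.pos-* ℤ.∣ x ∣ (suc m)) (sym (ℤP.*-identityˡ (+ suc n))) (ℤ.+≤+ ∣x∣*m≤n)

archimedean : ∀ k ε → 0ℚ ℚ.< ε → ∃ λ B → + k ℚ./ suc B ℚ.< ε
archimedean k (mkℚ (+ zero) d _)  (ℚ.*<* (ℤ.+<+ ()))
archimedean k (mkℚ -[1+ m ] d _)  (ℚ.*<* ())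
archimedean k (mkℚ (+ suc m) d _) _ = k ℕ.* suc d , ℚP.toℚᵘ-cancel-<
  (ℚᵘP.<-respˡ-≃ (ℚᵘP.≃-sym (ℚP.toℚᵘ-fromℚᵘ (mkℚᵘ (+ k) (k ℕ.* suc d)))) (*<* cross))
  where
  k*d<m*[k*d+1] : k ℕ.* suc d ℕ.< suc m ℕ.* suc (k ℕ.* suc d)
  k*d<m*[k*d+1] = ℕP.<-≤-trans (ℕP.n<1+n _) (ℕP.m≤n*m (suc (k ℕ.* suc d)) (suc m))
  cross : + k ℤ.* + suc d ℤ.< + suc m ℤ.* + suc (k ℕ.* suc d)
  cross = subst₂ ℤ._<_ (ℤP.pos-* k (suc d)) (ℤP.pos-* (suc m) (suc (k ℕ.* suc d)))
    (ℤ.+<+ k*d<m*[k*d+1])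

fibRatio : ℕ → ℚ
fibRatio m = frac (fib (+ suc m)) (fib (+ m))

fib*fib-nonZero : ∀ {a b} → 1 ≤ a → 1 ≤ b → ℤ.NonZero (fib (+ a) ℤ.* fib (+ b))
fib*fib-nonZero {a} {b} 1≤a 1≤b =
  ℤP.i*j≢0 (fib (+ a)) (fib (+ b)) {{fibℕ-nonZero 1≤a}} {{fibℕ-nonZero 1≤b}}

fibRatio-*-fib : ∀ {m} → 1 ≤ m → fibRatio m ℚ.* fromℤ (fib (+ m)) ≡ fromℤ (fib (+ suc m))
fibRatio-*-fib {m} 1≤m = frac-*-den (fib (+ suc m)) (fib (+ m)) {{fibℕ-nonZero 1≤m}}

fibRatio-sub : ∀ {a b} → 1 ≤ a → 1 ≤ b →
  fibRatio a ℚ.- fibRatio b ≡ frac (negOnePowℕ a ℤ.* fib (+ b - + a)) (fib (+ a) ℤ.* fib (+ b))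
fibRatio-sub {a} {b} 1≤a 1≤b = frac-unique _ _ (Fa ℤ.* Fb) {{fib*fib-nonZero 1≤a 1≤b}} (begin
  (fibRatio a ℚ.- fibRatio b) ℚ.* fromℤ (Fa ℤ.* Fb)
    ≡⟨ cong ((fibRatio a ℚ.- fibRatio b) ℚ.*_) (fromℤ-* Fa Fb) ⟩
  (fibRatio a ℚ.- fibRatio b) ℚ.* (fromℤ Fa ℚ.* fromℤ Fb)
    ≡⟨ solve 4 (λ x y A B → (x :- y) :* (A :* B) := x :* A :* B :- y :* B :* A) refl
         (fibRatio a) (fibRatio b) (fromℤ Fa) (fromℤ Fb) ⟩
  fibRatio a ℚ.* fromℤ Fa ℚ.* fromℤ Fb ℚ.- fibRatio b ℚ.* fromℤ Fb ℚ.* fromℤ Fa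
    ≡⟨ cong₂ (λ x y → x ℚ.* fromℤ Fb ℚ.- y ℚ.* fromℤ Fa) (fibRatio-*-fib 1≤a) (fibRatio-*-fib 1≤b) ⟩
  fromℤ (fib (+ suc a)) ℚ.* fromℤ Fb ℚ.- fromℤ (fib (+ suc b)) ℚ.* fromℤ Fa
    ≡⟨ sym (cong₂ ℚ._-_ (fromℤ-* (fib (+ suc a)) Fb) (fromℤ-* (fib (+ suc b)) Fa)) ⟩
  fromℤ (fib (+ suc a) ℤ.* Fb) ℚ.- fromℤ (fib (+ suc b) ℤ.* Fa)
    ≡⟨ sym (fromℤ-- (fib (+ suc a) ℤ.* Fb) (fib (+ suc b) ℤ.* Fa)) ⟩
  fromℤ (fib (+ suc a) ℤ.* Fb - fib (+ suc b) ℤ.* Fa)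
    ≡⟨ cong₂ (λ x y → fromℤ (x - fib y ℤ.* Fa)) (ℤP.*-comm (fib (+ suc a)) Fb) (cong +_ (ℕP.+-comm 1 b)) ⟩
  fromℤ (Fb ℤ.* fib (+ suc a) - fib (+ b ℤ.+ + 1) ℤ.* Fa)
    ≡⟨ cong fromℤ (fib-dOcagne a (+ b)) ⟩
  fromℤ (negOnePowℕ a ℤ.* fib (+ b - + a)) ∎)
  where
  open ≡-Reasoning
  open ℚSolver.+-*-Solver
  Fa Fb : ℤ
  Fa = fib (+ a)
  Fb = fib (+ b)

frac-fib-sub : ∀ c {a b} → 1 ≤ a → 1 ≤ b →
  frac (c ℤ.* fib (+ b - + a)) (fib (+ a) ℤ.* fib (+ b)) ≡
  fromℤ (c ℤ.* negOnePowℕ a) ℚ.* (fibRatio a ℚ.- fibRatio b)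
frac-fib-sub c {a} {b} 1≤a 1≤b = begin
  frac (c ℤ.* F) D                                ≡⟨ cong (λ x → frac x D) c*F≡cσ*σF ⟩
  frac (c ℤ.* σ ℤ.* (σ ℤ.* F)) D                  ≡⟨ frac-*ˡ (c ℤ.* σ) (σ ℤ.* F) D {{fib*fib-nonZero 1≤a 1≤b}} ⟩
  fromℤ (c ℤ.* σ) ℚ.* frac (σ ℤ.* F) D            ≡⟨ cong (fromℤ (c ℤ.* σ) ℚ.*_) (fibRatio-sub 1≤a 1≤b) ⟨
  fromℤ (c ℤ.* σ) ℚ.* (fibRatio a ℚ.- fibRatio b) ∎
  where
  open ≡-Reasoning
  open ℤSolver.+-*-Solver
  σ F D : ℤ
  σ = negOnePowℕ a
  F = fib (+ b - + a)
  D = fib (+ a) ℤ.* fib (+ b)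
  c*F≡cσ*σF : c ℤ.* F ≡ c ℤ.* σ ℤ.* (σ ℤ.* F)
  c*F≡cσ*σF = begin
    c ℤ.* F                  ≡⟨ cong (ℤ._* F) (ℤP.*-identityʳ c) ⟨
    c ℤ.* + 1 ℤ.* F          ≡⟨ cong (λ s → c ℤ.* s ℤ.* F) (negOnePowℕ-square a) ⟨
    c ℤ.* (σ ℤ.* σ) ℤ.* F    ≡⟨ solve 3 (λ c s F → c :* (s :* s) :* F := c :* s :* (s :* F)) refl c σ F ⟩
    c ℤ.* σ ℤ.* (σ ℤ.* F)    ∎

signed-fib-quotient : ∀ n {a b} → 1 ≤ a → 1 ≤ b →
  frac (negOnePow (+ a - + n) ℤ.* fib (+ b - + a)) (fib (+ a) ℤ.* fib (+ b)) ≡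
  fromℤ (negOnePowℕ n) ℚ.* (fibRatio a ℚ.- fibRatio b)
signed-fib-quotient n {a} {b} 1≤a 1≤b =
  trans (frac-fib-sub (negOnePow (+ a - + n)) 1≤a 1≤b)
        (cong (λ c → fromℤ c ℚ.* (fibRatio a ℚ.- fibRatio b)) sign≡)
  where
  sign≡ : negOnePow (+ a - + n) ℤ.* negOnePowℕ a ≡ negOnePowℕ n
  sign≡ = begin
    negOnePow (+ a - + n) ℤ.* negOnePowℕ a         ≡⟨ cong (ℤ._* negOnePowℕ a) (negOnePow-sub a n) ⟩
    negOnePowℕ a ℤ.* negOnePowℕ n ℤ.* negOnePowℕ a
      ≡⟨ solve 2 (λ s t → s :* t :* s := (s :* s) :* t) refl (negOnePowℕ a) (negOnePowℕ n) ⟩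
    negOnePowℕ a ℤ.* negOnePowℕ a ℤ.* negOnePowℕ n ≡⟨ cong (ℤ._* negOnePowℕ n) (negOnePowℕ-square a) ⟩
    + 1 ℤ.* negOnePowℕ n                           ≡⟨ ℤP.*-identityˡ (negOnePowℕ n) ⟩
    negOnePowℕ n                                   ∎
    where
    open ≡-Reasoning
    open ℤSolver.+-*-Solver

swapped-fib-quotient : ∀ {a b} → 1 ≤ a → 1 ≤ b →
  frac (negOnePow (+ a ℤ.+ + 1) ℤ.* fib (+ b - + a)) (fib (+ b) ℤ.* fib (+ a)) ≡ fibRatio b ℚ.- fibRatio a
swapped-fib-quotient {a} {b} 1≤a 1≤b = begin
  frac (c ℤ.* fib (+ b - + a)) (fib (+ b) ℤ.* fib (+ a))
    ≡⟨ cong (frac _) (ℤP.*-comm (fib (+ b)) (fib (+ a))) ⟩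
  frac (c ℤ.* fib (+ b - + a)) (fib (+ a) ℤ.* fib (+ b))
    ≡⟨ frac-fib-sub c 1≤a 1≤b ⟩
  fromℤ (c ℤ.* negOnePowℕ a) ℚ.* (fibRatio a ℚ.- fibRatio b)
    ≡⟨ cong (λ s → fromℤ s ℚ.* (fibRatio a ℚ.- fibRatio b)) c*σ≡-1 ⟩
  fromℤ (ℤ.- + 1) ℚ.* (fibRatio a ℚ.- fibRatio b)
    ≡⟨ solve 2 (λ x y → con (fromℤ (ℤ.- + 1)) :* (x :- y) := y :- x) refl (fibRatio a) (fibRatio b) ⟩
  fibRatio b ℚ.- fibRatio a ∎
  where
  open ≡-Reasoning
  open ℚSolver.+-*-Solver
  c : ℤ
  c = negOnePow (+ a ℤ.+ + 1)
  c*σ≡-1 : c ℤ.* negOnePowℕ a ≡ ℤ.- + 1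
  c*σ≡-1 = trans (cong (λ m → negOnePowℕ m ℤ.* negOnePowℕ a) (ℕP.+-comm a 1))
    (trans (sym (ℤP.neg-distribˡ-* (negOnePowℕ a) (negOnePowℕ a))) (cong ℤ.-_ (negOnePowℕ-square a)))

∣fibRatio-sub∣≤1/ : ∀ {a b B} → 1 ≤ a → 1 ≤ b → suc B ≤ fibℕ a → suc B ≤ fibℕ b →
  ℚ.∣ fibRatio a ℚ.- fibRatio b ∣ ℚ.≤ + 1 ℚ./ suc B
∣fibRatio-sub∣≤1/ {a} {b} {B} 1≤a 1≤b B<Fa B<Fb = subst (λ q → ℚ.∣ q ∣ ℚ.≤ + 1 ℚ./ suc B) (sym ratio≡)
  (∣frac∣≤1/ x (fibℕ a ℕ.* fibℕ b) (suc B) {{ℕP.m*n≢0 (fibℕ a) (fibℕ b) {{fibℕ-nonZero 1≤a}} {{fibℕ-nonZero 1≤b}}}}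
    (subst (λ n → n ℕ.* suc B ≤ fibℕ a ℕ.* fibℕ b) (sym ∣x∣≡) (fibℕ∣b-a∣*c≤fibℕa*fibℕb a b B<Fa B<Fb)))
  where
  x : ℤ
  x = negOnePowℕ a ℤ.* fib (+ b - + a)
  ratio≡ : fibRatio a ℚ.- fibRatio b ≡ frac x (+ (fibℕ a ℕ.* fibℕ b))
  ratio≡ = trans (fibRatio-sub 1≤a 1≤b) (cong (frac x) (sym (ℤP.pos-* (fibℕ a) (fibℕ b))))
  ∣x∣≡ : ℤ.∣ x ∣ ≡ fibℕ ℤ.∣ + b - + a ∣
  ∣x∣≡ = trans (ℤP.abs-* (negOnePowℕ a) (fib (+ b - + a)))
    (trans (cong₂ ℕ._*_ (∣negOnePowℕ∣≡1 a) (∣fib∣≡fibℕ∣∣ (+ b - + a))) (ℕP.*-identityˡ (fibℕ ℤ.∣ + b - + a ∣)))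

sum1-cong : ∀ {f g : ℕ → ℚ} → (∀ n → f (suc n) ≡ g (suc n)) → ∀ M → sum1 f M ≡ sum1 g M
sum1-cong f≗g zero    = refl
sum1-cong f≗g (suc M) = cong₂ ℚ._+_ (sum1-cong f≗g M) (f≗g M)

sum1-telescope : ∀ (h : ℕ → ℚ) d M →
  sum1 (λ n → h n ℚ.- h (n + d)) M ≡ sum1 h d ℚ.- (sum1 h (M + d) ℚ.- sum1 h M)
sum1-telescope h d zero    = solve 1 (λ s → con 0ℚ := s :- (s :- con 0ℚ)) refl (sum1 h d)
  where open ℚSolver.+-*-Solver
sum1-telescope h d (suc M) = begin
  sum1 (λ n → h n ℚ.- h (n + d)) M ℚ.+ (h (suc M) ℚ.- h (suc M + d))
    ≡⟨ cong (ℚ._+ (h (suc M) ℚ.- h (suc M + d))) (sum1-telescope h d M) ⟩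
  sum1 h d ℚ.- (sum1 h (M + d) ℚ.- sum1 h M) ℚ.+ (h (suc M) ℚ.- h (suc M + d))
    ≡⟨ solve 5 (λ a b c x y → a :- (b :- c) :+ (x :- y) := a :- ((b :+ y) :- (c :+ x))) refl
         (sum1 h d) (sum1 h (M + d)) (sum1 h M) (h (suc M)) (h (suc M + d)) ⟩
  sum1 h d ℚ.- (sum1 h (suc M + d) ℚ.- sum1 h (suc M)) ∎
  where
  open ≡-Reasoning
  open ℚSolver.+-*-Solver

sum1-pairs : ∀ (h : ℕ → ℚ) k → sum1 (λ n → h (2 * n ∸ 1) ℚ.+ h (2 * n)) k ≡ sum1 h (2 * k)
sum1-pairs h zero    = refl
sum1-pairs h (suc k) = begin
  sum1 (λ n → h (2 * n ∸ 1) ℚ.+ h (2 * n)) k ℚ.+ (h (2 * suc k ∸ 1) ℚ.+ h (2 * suc k))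
    ≡⟨ cong₂ ℚ._+_ (sum1-pairs h k) (cong (λ m → h (m ∸ 1) ℚ.+ h m) (ℕP.*-suc 2 k)) ⟩
  sum1 h (2 * k) ℚ.+ (h (suc (2 * k)) ℚ.+ h (suc (suc (2 * k))))
    ≡⟨ ℚP.+-assoc (sum1 h (2 * k)) (h (suc (2 * k))) (h (suc (suc (2 * k)))) ⟨
  sum1 h (suc (suc (2 * k)))
    ≡⟨ cong (sum1 h) (ℕP.*-suc 2 k) ⟨
  sum1 h (2 * suc k) ∎
  where open ≡-Reasoning

∣sum1-pairs-tail∣≤ : ∀ (h : ℕ → ℚ) M δ → (∀ n → M ≤ n → ℚ.∣ h (suc n) ℚ.+ h (suc (suc n)) ∣ ℚ.≤ δ) →
  ∀ j → ℚ.∣ sum1 h (M + 2 * j) ℚ.- sum1 h M ∣ ℚ.≤ fromℤ (+ j) ℚ.* δ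
∣sum1-pairs-tail∣≤ h M δ pair≤δ zero rewrite ℕP.+-identityʳ M | ℚP.+-inverseʳ (sum1 h M) =
  ℚP.≤-reflexive (sym (ℚP.*-zeroˡ δ))
∣sum1-pairs-tail∣≤ h M δ pair≤δ (suc j)
  rewrite ℕP.*-suc 2 j | ℕP.+-suc M (suc (2 * j)) | ℕP.+-suc M (2 * j) = begin
  ℚ.∣ S x ℚ.+ h (suc x) ℚ.+ h (suc (suc x)) ℚ.- S M ∣
    ≡⟨ cong ℚ.∣_∣ (solve 4 (λ a b c d → a :+ c :+ d :- b := (a :- b) :+ (c :+ d)) refl
         (S x) (S M) (h (suc x)) (h (suc (suc x)))) ⟩
  ℚ.∣ (S x ℚ.- S M) ℚ.+ (h (suc x) ℚ.+ h (suc (suc x))) ∣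
    ≤⟨ ℚP.∣p+q∣≤∣p∣+∣q∣ (S x ℚ.- S M) (h (suc x) ℚ.+ h (suc (suc x))) ⟩
  ℚ.∣ S x ℚ.- S M ∣ ℚ.+ ℚ.∣ h (suc x) ℚ.+ h (suc (suc x)) ∣
    ≤⟨ ℚP.+-mono-≤ (∣sum1-pairs-tail∣≤ h M δ pair≤δ j) (pair≤δ x (ℕP.m≤m+n M (2 * j))) ⟩
  fromℤ (+ j) ℚ.* δ ℚ.+ δ
    ≡⟨ solve 2 (λ J δ → J :* δ :+ δ := (con 1ℚ :+ J) :* δ) refl (fromℤ (+ j)) δ ⟩
  (1ℚ ℚ.+ fromℤ (+ j)) ℚ.* δ
    ≡⟨ cong (ℚ._* δ) (sym (fromℤ-+ (+ 1) (+ j))) ⟩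
  fromℤ (+ suc j) ℚ.* δ ∎
  where
  open ℚP.≤-Reasoning
  open ℚSolver.+-*-Solver
  S : ℕ → ℚ
  S = sum1 h
  x : ℕ
  x = M + 2 * j

SeriesConvergesTo-cong : ∀ {f g L} → (∀ n → f (suc n) ≡ g (suc n)) →
  SeriesConvergesTo f L → SeriesConvergesTo g L
SeriesConvergesTo-cong {L = L} f≗g f→L ε ε>0 with f→L ε ε>0
... | N , close = N , λ M N≤M → subst (λ s → ℚ.∣ s ℚ.- L ∣ ℚ.< ε) (sum1-cong f≗g M) (close M N≤M)

lagged-telescope-converges : ∀ (h : ℕ → ℚ) k →
  (∀ B → ∃ λ N → ∀ n → N ≤ n → ℚ.∣ h (suc n) ℚ.+ h (suc (suc n)) ∣ ℚ.≤ + 1 ℚ./ suc B) →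
  SeriesConvergesTo (λ n → h n ℚ.- h (n + 2 * k)) (sum1 h (2 * k))
lagged-telescope-converges h k pairs→0 ε ε>0 with archimedean k ε ε>0
... | B , k/B<ε with pairs→0 B
... | N , pair≤ = N , λ M N≤M → begin-strict
  ℚ.∣ sum1 (λ n → h n ℚ.- h (n + 2 * k)) M ℚ.- S (2 * k) ∣
    ≡⟨ cong (λ s → ℚ.∣ s ℚ.- S (2 * k) ∣) (sum1-telescope h (2 * k) M) ⟩
  ℚ.∣ S (2 * k) ℚ.- (S (M + 2 * k) ℚ.- S M) ℚ.- S (2 * k) ∣
    ≡⟨ cong ℚ.∣_∣ (solve 2 (λ a t → a :- t :- a := :- t) refl (S (2 * k)) (S (M + 2 * k) ℚ.- S M)) ⟩
  ℚ.∣ ℚ.- (S (M + 2 * k) ℚ.- S M) ∣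
    ≡⟨ ℚP.∣-p∣≡∣p∣ (S (M + 2 * k) ℚ.- S M) ⟩
  ℚ.∣ S (M + 2 * k) ℚ.- S M ∣
    ≤⟨ ∣sum1-pairs-tail∣≤ h M (+ 1 ℚ./ suc B) (λ n M≤n → pair≤ n (ℕP.≤-trans N≤M M≤n)) k ⟩
  fromℤ (+ k) ℚ.* (+ 1 ℚ./ suc B)
    ≡⟨ sym (frac-*ˡ (+ k) (+ 1) (+ suc B)) ⟩
  frac (+ k ℤ.* + 1) (+ suc B)
    ≡⟨ cong (λ x → frac x (+ suc B)) (ℤP.*-identityʳ (+ k)) ⟩
  + k ℚ./ suc B
    <⟨ k/B<ε ⟩
  ε ∎
  where
  open ℚP.≤-Reasoning
  open ℚSolver.+-*-Solver
  S : ℕ → ℚ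
  S = sum1 h

signedFibRatio : (ℕ → ℕ) → ℕ → ℚ
signedFibRatio u n = fromℤ (negOnePowℕ n) ℚ.* fibRatio (u n)

signedFibRatio-+1 : ∀ u m → signedFibRatio u m ℚ.+ signedFibRatio u (suc m) ≡
  fromℤ (negOnePowℕ m) ℚ.* (fibRatio (u m) ℚ.- fibRatio (u (suc m)))
signedFibRatio-+1 u m rewrite fromℤ-neg (negOnePowℕ m) =
  solve 3 (λ s x y → s :* x :+ (:- s) :* y := s :* (x :- y)) refl
    (fromℤ (negOnePowℕ m)) (fibRatio (u m)) (fibRatio (u (suc m)))
  where open ℚSolver.+-*-Solver

signedFibRatio-+2k : ∀ u n k → signedFibRatio u n ℚ.- signedFibRatio u (n + 2 * k) ≡
  fromℤ (negOnePowℕ n) ℚ.* (fibRatio (u n) ℚ.- fibRatio (u (n + 2 * k)))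
signedFibRatio-+2k u n k rewrite negOnePowℕ-+ n (2 * k) | negOnePowℕ-even k | ℤP.*-identityʳ (negOnePowℕ n) =
  solve 3 (λ s x y → s :* x :- s :* y := s :* (x :- y)) refl
    (fromℤ (negOnePowℕ n)) (fibRatio (u n)) (fibRatio (u (n + 2 * k)))
  where open ℚSolver.+-*-Solver

signedFibRatio-oddPair : ∀ u j → signedFibRatio u (2 * suc j ∸ 1) ℚ.+ signedFibRatio u (2 * suc j) ≡
  fibRatio (u (2 * suc j)) ℚ.- fibRatio (u (2 * suc j ∸ 1))
signedFibRatio-oddPair u j = begin
  signedFibRatio u (2 * suc j ∸ 1) ℚ.+ signedFibRatio u (2 * suc j)
    ≡⟨ cong (λ m → signedFibRatio u (m ∸ 1) ℚ.+ signedFibRatio u m) (ℕP.*-suc 2 j) ⟩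
  signedFibRatio u (suc (2 * j)) ℚ.+ signedFibRatio u (suc (suc (2 * j)))
    ≡⟨ signedFibRatio-+1 u (suc (2 * j)) ⟩
  fromℤ (ℤ.- negOnePowℕ (2 * j)) ℚ.* (x ℚ.- y)
    ≡⟨ cong (λ s → fromℤ (ℤ.- s) ℚ.* (x ℚ.- y)) (negOnePowℕ-even j) ⟩
  fromℤ (ℤ.- + 1) ℚ.* (x ℚ.- y)
    ≡⟨ solve 2 (λ x y → con (fromℤ (ℤ.- + 1)) :* (x :- y) := y :- x) refl x y ⟩
  y ℚ.- x
    ≡⟨ cong (λ m → fibRatio (u m) ℚ.- fibRatio (u (m ∸ 1))) (ℕP.*-suc 2 j) ⟨
  fibRatio (u (2 * suc j)) ℚ.- fibRatio (u (2 * suc j ∸ 1)) ∎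
  where
  open ≡-Reasoning
  open ℚSolver.+-*-Solver
  x y : ℚ
  x = fibRatio (u (suc (2 * j)))
  y = fibRatio (u (suc (suc (2 * j))))

signedFibRatio-pairs→0 : ∀ {u} → (∀ n → 1 ≤ n → 1 ≤ u n) → TendsToInfinity u →
  ∀ B → ∃ λ N → ∀ n → N ≤ n →
    ℚ.∣ signedFibRatio u (suc n) ℚ.+ signedFibRatio u (suc (suc n)) ∣ ℚ.≤ + 1 ℚ./ suc B
signedFibRatio-pairs→0 {u} u≥1 u→∞ B with fibℕ∘-tendsToInfinity u→∞ (suc B)
... | N , B<Fu = N , λ n N≤n → begin
  ℚ.∣ signedFibRatio u (suc n) ℚ.+ signedFibRatio u (suc (suc n)) ∣
    ≡⟨ cong ℚ.∣_∣ (signedFibRatio-+1 u (suc n)) ⟩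
  ℚ.∣ fromℤ (negOnePowℕ (suc n)) ℚ.* (fibRatio (u (suc n)) ℚ.- fibRatio (u (suc (suc n)))) ∣
    ≡⟨ ∣fromℤ-negOnePowℕ*q∣≡∣q∣ (suc n) (fibRatio (u (suc n)) ℚ.- fibRatio (u (suc (suc n)))) ⟩
  ℚ.∣ fibRatio (u (suc n)) ℚ.- fibRatio (u (suc (suc n))) ∣
    ≤⟨ ∣fibRatio-sub∣≤1/ (u≥1 (suc n) (s≤s z≤n)) (u≥1 (suc (suc n)) (s≤s z≤n))
         (B<Fu (suc n) (ℕP.m≤n⇒m≤1+n N≤n)) (B<Fu (suc (suc n)) (ℕP.m≤n⇒m≤1+n (ℕP.m≤n⇒m≤1+n N≤n))) ⟩
  + 1 ℚ./ suc B ∎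
  where open ℚP.≤-Reasoning

fib-quotient-series : (u : ℕ → ℕ) → (∀ n → 1 ≤ n → 1 ≤ u n) → TendsToInfinity u → (k : ℕ) →
  SeriesConvergesTo
    (λ n → frac (negOnePow (+ u n - + n) ℤ.* fib (+ u (n + 2 * k) - + u n))
                (fib (+ u n) ℤ.* fib (+ u (n + 2 * k))))
    (sum1 (λ n → frac (negOnePow (+ u (2 * n ∸ 1) ℤ.+ + 1) ℤ.* fib (+ u (2 * n) - + u (2 * n ∸ 1)))
                      (fib (+ u (2 * n)) ℤ.* fib (+ u (2 * n ∸ 1)))) k)
fib-quotient-series u u≥1 u→∞ k =
  SeriesConvergesTo-cong (λ n → sym (term≡ n))
    (subst (SeriesConvergesTo _) (sym limit≡) (lagged-telescope-converges h k (signedFibRatio-pairs→0 u≥1 u→∞)))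
  where
  h : ℕ → ℚ
  h = signedFibRatio u
  term≡ : ∀ n → frac (negOnePow (+ u (suc n) - + suc n) ℤ.* fib (+ u (suc n + 2 * k) - + u (suc n)))
                     (fib (+ u (suc n)) ℤ.* fib (+ u (suc n + 2 * k)))
              ≡ h (suc n) ℚ.- h (suc n + 2 * k)
  term≡ n = trans (signed-fib-quotient (suc n) (u≥1 _ (s≤s z≤n)) (u≥1 _ (s≤s z≤n)))
                  (sym (signedFibRatio-+2k u (suc n) k))
  limit≡ : sum1 (λ n → frac (negOnePow (+ u (2 * n ∸ 1) ℤ.+ + 1) ℤ.* fib (+ u (2 * n) - + u (2 * n ∸ 1)))
                            (fib (+ u (2 * n)) ℤ.* fib (+ u (2 * n ∸ 1)))) k
           ≡ sum1 h (2 * k)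
  limit≡ = trans (sum1-cong (λ j → trans (swapped-fib-quotient (u≥1 _ (1≤2*[1+j]∸1 j)) (u≥1 _ (s≤s z≤n)))
                                         (sym (signedFibRatio-oddPair u j))) k)
                 (sum1-pairs h k)

theorem2p5 : (u : ℕ → ℕ) → (∀ n → 1 ≤ n → 1 ≤ u n) → TendsToInfinity u →
    (k : ℕ) → 1 ≤ k →
      SeriesConvergesTo
        (λ n → frac (negOnePow (+ u n - + n) Data.Integer.* fib (+ u (n + 2 * k) - + u n))
                    (fib (+ u n) Data.Integer.* fib (+ u (n + 2 * k))))
        (sum1 (λ n → frac (negOnePow (+ u (2 * n ∸ 1) Data.Integer.+ + 1) Data.Integer.* fib (+ u (2 * n) - + u (2 * n ∸ 1)))
                          (fib (+ u (2 * n)) Data.Integer.* fib (+ u (2 * n ∸ 1)))) k)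
      ×
      ((∀ n → 1 ≤ n → u n % 2 ≡ n % 2) →
        SeriesConvergesTo
          (λ n → frac (fib (+ u (n + 2 * k) - + u n))
                      (fib (+ u n) Data.Integer.* fib (+ u (n + 2 * k))))
          (sum1 (λ n → frac (fib (+ u (2 * n) - + u (2 * n ∸ 1)))
                            (fib (+ u (2 * n)) Data.Integer.* fib (+ u (2 * n ∸ 1)))) k))
theorem2p5 u u≥1 u→∞ k _ =
  fib-quotient-series u u≥1 u→∞ k ,
  λ u≡n[2] → SeriesConvergesTo-cong
    (λ n → frac-*ˡ-+1 (fib (+ u (suc n + 2 * k) - + u (suc n)))
                      (fib (+ u (suc n)) ℤ.* fib (+ u (suc n + 2 * k)))
                      (negOnePow-sub≡1 (u (suc n)) (suc n) (u≡n[2] (suc n) (s≤s z≤n))))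
    (subst (SeriesConvergesTo _)
      (sum1-cong (λ j → frac-*ˡ-+1 (fib (+ u (2 * suc j) - + u (2 * suc j ∸ 1)))
                                   (fib (+ u (2 * suc j)) ℤ.* fib (+ u (2 * suc j ∸ 1)))
                                   (negOnePow-+1≡1 (u (2 * suc j ∸ 1)) j (u≡n[2] (2 * suc j ∸ 1) (1≤2*[1+j]∸1 j)))) k)
      (fib-quotient-series u u≥1 u→∞ k))
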